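{- Let $G$ be a 2-vertex-connected outerplanar graph with weak dual $\tilde T$ and weight function $w(v_f)=|E(f)|-2$. Let $C$ be a cycle in $G$ and $V'=\{v_f\in V(\tilde T): f\in \mathrm{Enc}(C)\}$. Then $\mathrm{cost}(V')=|C|-2$.
   Context: Graphs are simple, finite, undirected. $G$ is embedded with all vertices on the boundary of the exterior face; bounded faces are interior faces, $\mathrm{Int\text{ - }faces}(G)$ their set, $E(f)$ the edge set of face $f$. The weak dual $\tilde T$ has vertices $v_f$ for $f\in\mathrm{Int\text{ - }faces}(G)$ and edges $(v_f,v_g)$ whenever $|E(f)\cap E(g)|=1$. For a cycle $C$ in $G$, $\mathrm{Enc}(C)$ is the set of interior faces of $G[V(C)]$ (with the embedding inherited from $G$). For $X\subseteq V(\tilde T)$, $\mathrm{cost}(X)=\sum_{v\in X}w(v)$. $|C|$ is the number of edges of $C$. -}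

module Defs where

open import Data.Nat as ℕ using (ℕ; _∸_)
open import Data.Fin as F using (Fin)
open import Data.Fin.Subset using (Subset; ∣_∣) renaming (_∈_ to _∈ₛ_)
open import Data.List using (List; []; _∷_; _++_; length; map)
open import Data.Nat.ListAction using (sum)
open import Data.List.Membership.Propositional using (_∈_)
open import Data.List.Relation.Unary.Unique.Propositional using (Unique)
open import Data.List.Relation.Unary.Linked using (Linked)
open import Data.Product using (_×_)
open import Data.Sum using (_⊎_)
open import Data.Unit using (⊤)
open import Data.Empty using (⊥)
open import Function.Bundles using (_⇔_)
open import Relation.Nullary using (¬_)
open import Relation.Binary.PropositionalEquality using (_≢_)

-- Convention: an outerplanar graph embedded with all vertices on the
-- exterior face is represented by its vertices 0,…,n-1 listed in the
-- cyclic order in which they appear around the exterior face (convex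
-- drawing); edges are chords and no two edges cross.
record OuterplanarGraph (n : ℕ) : Set₁ where
  field
    E        : Fin n → Fin n → Set
    E-sym    : ∀ {x y} → E x y → E y x
    E-irrefl : ∀ {x} → ¬ E x x
    noncrossing : ∀ {a b c d} → E a b → E c d →
                  ¬ (a F.< c × c F.< b × b F.< d)
open OuterplanarGraph public

data Reach {n : ℕ} (R : Fin n → Fin n → Set) (Allowed : Fin n → Set)
           : Fin n → Fin n → Set where
  here  : ∀ {x} → Allowed x → Reach R Allowed x x
  there : ∀ {x y z} → Allowed x → R x y → Reach R Allowed y z →
          Reach R Allowed x z

Connected : ∀ {n} → OuterplanarGraph n → Set
Connected G = ∀ x y → Reach (E G) (λ _ → ⊤) x y

TwoConnected : ∀ {n} → OuterplanarGraph n → Set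
TwoConnected {n} G =
  3 ℕ.≤ n × Connected G ×
  (∀ v x y → x ≢ v → y ≢ v → Reach (E G) (λ z → z ≢ v) x y)

IsCycle : ∀ {n} → (Fin n → Fin n → Set) → List (Fin n) → Set
IsCycle R []       = ⊥
IsCycle R (x ∷ xs) =
  3 ℕ.≤ length (x ∷ xs) × Unique (x ∷ xs) × Linked R (x ∷ xs ++ x ∷ [])

-- |C| = number of edges of the cycle = number of its vertices
cycleLength : ∀ {n} → List (Fin n) → ℕ
cycleLength = length

-- For a vertex subset S (in convex position), x < y in S form a side of
-- the convex polygon spanned by S iff they are cyclically consecutive in S.
Side : ∀ {n} → Subset n → Fin n → Fin n → Set
Side S x y =
  (∀ z → z ∈ₛ S → ¬ (x F.< z × z F.< y)) ⊎
  (∀ z → z ∈ₛ S → (x F.≤ z × z F.≤ y))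

-- Interior (bounded) faces of a non-crossing convex drawing of a graph
-- with vertex set U and edge relation R: exactly the vertex sets S ⊆ U
-- with |S| ≥ 3 whose polygon sides are all edges and which have no
-- edge between non-consecutive vertices (no chord inside).
IsIntFace : ∀ {n} → (Fin n → Set) → (Fin n → Fin n → Set) → Subset n → Set
IsIntFace U R S =
  (∀ x → x ∈ₛ S → U x) × 3 ℕ.≤ ∣ S ∣ ×
  (∀ x y → x ∈ₛ S → y ∈ₛ S → x F.< y → (R x y ⇔ Side S x y))

IntFaces : ∀ {n} → OuterplanarGraph n → Subset n → Set
IntFaces G = IsIntFace (λ _ → ⊤) (E G)

-- induced subgraph G[V(C)] (inherits the embedding, i.e. the vertex order)
inducedE : ∀ {n} → OuterplanarGraph n → (Fin n → Set) → Fin n → Fin n → Set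
inducedE G U x y = U x × U y × E G x y

Enc : ∀ {n} → OuterplanarGraph n → List (Fin n) → Subset n → Set
Enc G c = IsIntFace (λ x → x ∈ c) (inducedE G (λ x → x ∈ c))

-- |E(f)| : a face polygon with vertex set S has |S| edges
faceEdgeCount : ∀ {n} → Subset n → ℕ
faceEdgeCount S = ∣ S ∣

w : ∀ {n} → Subset n → ℕ
w f = faceEdgeCount f ∸ 2

-- cost of a (duplicate-free) list of dual vertices
cost : ∀ {n} → List (Subset n) → ℕ
cost X = sum (map w X)

module Submission where

-- Call a vertex set U a polygon if every side of its convex hull is an edge
-- of G.  The proof has two halves.
--   * The faces of a polygon U have total weight |U| - 2 (`polygon-cost`), by
--     strong induction on |U|.  If no edge of G is a chord of U, then U is its
--     own unique face.  A chord xy cuts U into the polygons U₁ = U ∩ [x, y]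
--     and U₂ = U ∖ (x, y) with |U₁| + |U₂| = |U| + 2, and since a face never
--     has vertices on both sides of an edge (`face-one-side`), the faces of U
--     are those of U₁ together with those of U₂.
--   * The vertex set of a cycle is a polygon (`cycle⇒polygon`): if a hull side
--     ab were not an edge, the two neighbours of a on the cycle would be
--     joined to b by the two arcs of the cycle, and one of these arcs would
--     cross an edge at a (`no-two-arcs`).

open import Defs
open import Data.Empty using (⊥-elim) renaming (⊥ to Empty)
open import Data.Fin as Fin using (Fin; _<_; _≤_)
import Data.Fin.Properties as FP
open import Data.Fin.Subset using (Subset; ∣_∣; ⁅_⁆; _∪_; _∩_; _⊆_; inside; outside)
  renaming (_∈_ to _∈ₛ_; _∉_ to _∉ₛ_; ⊥ to ∅)
open import Data.Fin.Subset.Properties using (_∈?_)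
import Data.Fin.Subset.Properties as SP
open import Data.List using (List; []; _∷_; _++_; length; filter; initLast; _∷ʳ′_)
import Data.List.Properties as LP
open import Data.List.Membership.Propositional using (_∈_; _∉_)
open import Data.List.Membership.Propositional.Properties
  using (∈-filter⁺; ∈-filter⁻; ∈-∃++; ∈-++⁺ˡ; ∈-++⁺ʳ; ∈-++⁻)
open import Data.List.Relation.Unary.All using (_∷_)
import Data.List.Relation.Unary.All as All
import Data.List.Relation.Unary.All.Properties as AllP
open import Data.List.Relation.Unary.AllPairs as AllPairs using ([]; _∷_)
open import Data.List.Relation.Unary.Any using (here; there)
open import Data.List.Relation.Unary.Linked as Linked using (Linked; [-]; _∷_)
open import Data.List.Relation.Unary.Unique.Propositional using (Unique)
open import Data.List.Relation.Unary.Unique.Propositional.Properties using (Unique[x∷xs]⇒x∉xs; filter⁺)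
import Data.List.Relation.Unary.Unique.Propositional.Properties as UniqueP
open import Data.Nat as ℕ using (zero; suc; _+_; _∸_; z≤n; s≤s)
open import Data.Nat.Induction using (<-wellFounded)
import Data.Nat.Properties as ℕP
open import Algebra.Properties.CommutativeSemigroup ℕP.+-commutativeSemigroup using (x∙yz≈y∙xz)
open import Data.Product using (Σ; _×_; _,_; proj₁; proj₂)
open import Data.Sum using (_⊎_; inj₁; inj₂; [_,_])
open import Data.Vec using ([]; _∷_; tabulate)
import Data.Vec.Properties as VP
open import Function using (case_of_; _∘_)
open import Function.Bundles using (_⇔_; mk⇔; Equivalence)
open import Induction.WellFounded using (Acc; acc)
open import Relation.Binary using (tri<; tri≈; tri>)
open import Relation.Binary.PropositionalEquality
  using (_≡_; _≢_; refl; sym; trans; cong; cong₂; subst; subst₂; module ≡-Reasoning)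
open import Relation.Nullary using (¬_; Dec; yes; no; does)
open import Relation.Nullary.Decidable
  using (_×-dec_; _⊎-dec_; ¬?; _→-dec_; decidable-stable; ¬¬-excluded-middle)
open import Relation.Unary using (Decidable)

∣∪∣+∣∩∣ : ∀ {n} (p q : Subset n) → ∣ p ∪ q ∣ + ∣ p ∩ q ∣ ≡ ∣ p ∣ + ∣ q ∣
∣∪∣+∣∩∣ []            []            = refl
∣∪∣+∣∩∣ (outside ∷ p) (outside ∷ q) = ∣∪∣+∣∩∣ p q
∣∪∣+∣∩∣ (inside  ∷ p) (outside ∷ q) = cong suc (∣∪∣+∣∩∣ p q)
∣∪∣+∣∩∣ (outside ∷ p) (inside  ∷ q) =
  trans (cong suc (∣∪∣+∣∩∣ p q)) (sym (ℕP.+-suc ∣ p ∣ ∣ q ∣))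
∣∪∣+∣∩∣ (inside  ∷ p) (inside  ∷ q) =
  cong suc (trans (ℕP.+-suc ∣ p ∪ q ∣ ∣ p ∩ q ∣)
                  (trans (cong suc (∣∪∣+∣∩∣ p q)) (sym (ℕP.+-suc ∣ p ∣ ∣ q ∣))))

∣∪∣≤ : ∀ {n} (p q : Subset n) → ∣ p ∪ q ∣ ℕ.≤ ∣ p ∣ + ∣ q ∣
∣∪∣≤ p q = subst (∣ p ∪ q ∣ ℕ.≤_) (∣∪∣+∣∩∣ p q) (ℕP.m≤m+n ∣ p ∪ q ∣ ∣ p ∩ q ∣)

∣∪∣-disjoint : ∀ {n} (p q : Subset n) → (∀ {x} → x ∈ₛ p → x ∉ₛ q) →
               ∣ p ∪ q ∣ ≡ ∣ p ∣ + ∣ q ∣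
∣∪∣-disjoint {n} p q disj = begin
  ∣ p ∪ q ∣             ≡⟨ sym (ℕP.+-identityʳ ∣ p ∪ q ∣) ⟩
  ∣ p ∪ q ∣ + 0         ≡⟨ cong (∣ p ∪ q ∣ +_) (SP.∣⊥∣≡0 n) ⟨
  ∣ p ∪ q ∣ + ∣ ∅ {n} ∣ ≡⟨ cong (λ s → ∣ p ∪ q ∣ + ∣ s ∣) p∩q≡∅ ⟨
  ∣ p ∪ q ∣ + ∣ p ∩ q ∣ ≡⟨ ∣∪∣+∣∩∣ p q ⟩
  ∣ p ∣ + ∣ q ∣         ∎
  where
  open ≡-Reasoning
  p∩q≡∅ : p ∩ q ≡ ∅ {n}
  p∩q≡∅ = SP.Empty-unique λ (x , x∈p∩q) → let x∈p , x∈q = SP.x∈p∩q⁻ p q x∈p∩q in disj x∈p x∈q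

pair : ∀ {n} → Fin n → Fin n → Subset n
pair a b = ⁅ a ⁆ ∪ ⁅ b ⁆

∈pair⁺ : ∀ {n} {a b z : Fin n} → z ≡ a ⊎ z ≡ b → z ∈ₛ pair a b
∈pair⁺ (inj₁ refl) = SP.x∈p∪q⁺ (inj₁ (SP.x∈⁅x⁆ _))
∈pair⁺ (inj₂ refl) = SP.x∈p∪q⁺ (inj₂ (SP.x∈⁅x⁆ _))

∈pair⁻ : ∀ {n} {a b z : Fin n} → z ∈ₛ pair a b → z ≡ a ⊎ z ≡ b
∈pair⁻ {a = a} {b} z∈ with SP.x∈p∪q⁻ ⁅ a ⁆ ⁅ b ⁆ z∈
... | inj₁ z∈a = inj₁ (SP.x∈⁅y⁆⇒x≡y a z∈a)
... | inj₂ z∈b = inj₂ (SP.x∈⁅y⁆⇒x≡y b z∈b)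

∣pair∣≡2 : ∀ {n} {a b : Fin n} → a ≢ b → ∣ pair a b ∣ ≡ 2
∣pair∣≡2 {a = a} {b} a≢b =
  trans (∣∪∣-disjoint ⁅ a ⁆ ⁅ b ⁆ λ z∈a z∈b → a≢b (trans (sym (SP.x∈⁅y⁆⇒x≡y a z∈a)) (SP.x∈⁅y⁆⇒x≡y b z∈b)))
        (cong₂ _+_ (SP.∣⁅x⁆∣≡1 a) (SP.∣⁅x⁆∣≡1 b))

⊆pair⇒∣∣≤2 : ∀ {n} {f : Subset n} {a b} → (∀ {z} → z ∈ₛ f → z ≡ a ⊎ z ≡ b) → ∣ f ∣ ℕ.≤ 2
⊆pair⇒∣∣≤2 {f = f} {a} {b} f⊆ab = begin
  ∣ f ∣                 ≤⟨ SP.p⊆q⇒∣p∣≤∣q∣ (λ z∈f → ∈pair⁺ (f⊆ab z∈f)) ⟩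
  ∣ pair a b ∣          ≤⟨ ∣∪∣≤ ⁅ a ⁆ ⁅ b ⁆ ⟩
  ∣ ⁅ a ⁆ ∣ + ∣ ⁅ b ⁆ ∣ ≡⟨ cong₂ _+_ (SP.∣⁅x⁆∣≡1 a) (SP.∣⁅x⁆∣≡1 b) ⟩
  2                     ∎
  where open ℕP.≤-Reasoning

three≤∣∣ : ∀ {n} {S : Subset n} {x y z} → x ∈ₛ S → y ∈ₛ S → z ∈ₛ S →
           x ≢ y → x ≢ z → y ≢ z → 3 ℕ.≤ ∣ S ∣
three≤∣∣ {S = S} {x} {y} {z} x∈S y∈S z∈S x≢y x≢z y≢z = begin
  3                         ≡⟨ cong₂ _+_ (∣pair∣≡2 x≢y) (SP.∣⁅x⁆∣≡1 z) ⟨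
  ∣ pair x y ∣ + ∣ ⁅ z ⁆ ∣  ≡⟨ ∣∪∣-disjoint (pair x y) ⁅ z ⁆ z∉xy ⟨
  ∣ pair x y ∪ ⁅ z ⁆ ∣      ≤⟨ SP.p⊆q⇒∣p∣≤∣q∣ xyz⊆S ⟩
  ∣ S ∣                     ∎
  where
  open ℕP.≤-Reasoning
  z∉xy : ∀ {w} → w ∈ₛ pair x y → w ∉ₛ ⁅ z ⁆
  z∉xy w∈xy w∈z with SP.x∈⁅y⁆⇒x≡y z w∈z | ∈pair⁻ w∈xy
  ... | refl | inj₁ refl = x≢z refl
  ... | refl | inj₂ refl = y≢z refl
  xyz⊆S : pair x y ∪ ⁅ z ⁆ ⊆ S
  xyz⊆S w∈ with SP.x∈p∪q⁻ (pair x y) ⁅ z ⁆ w∈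
  ... | inj₂ w∈z with refl ← SP.x∈⁅y⁆⇒x≡y z w∈z = z∈S
  ... | inj₁ w∈xy with ∈pair⁻ w∈xy
  ...   | inj₁ refl = x∈S
  ...   | inj₂ refl = y∈S

listSet : ∀ {n} → List (Fin n) → Subset n
listSet []       = ∅
listSet (x ∷ xs) = ⁅ x ⁆ ∪ listSet xs

∈listSet⁺ : ∀ {n} {z : Fin n} {xs} → z ∈ xs → z ∈ₛ listSet xs
∈listSet⁺ (here refl) = SP.x∈p∪q⁺ (inj₁ (SP.x∈⁅x⁆ _))
∈listSet⁺ (there z∈xs) = SP.x∈p∪q⁺ (inj₂ (∈listSet⁺ z∈xs))

∈listSet⁻ : ∀ {n} {z : Fin n} xs → z ∈ₛ listSet xs → z ∈ xs
∈listSet⁻ []       z∈ = ⊥-elim (SP.∉⊥ z∈)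
∈listSet⁻ (x ∷ xs) z∈ with SP.x∈p∪q⁻ ⁅ x ⁆ (listSet xs) z∈
... | inj₁ z∈x  = here (SP.x∈⁅y⁆⇒x≡y x z∈x)
... | inj₂ z∈xs = there (∈listSet⁻ xs z∈xs)

∣listSet∣ : ∀ {n} (xs : List (Fin n)) → Unique xs → ∣ listSet xs ∣ ≡ length xs
∣listSet∣ {n} []       _               = SP.∣⊥∣≡0 n
∣listSet∣     (x ∷ xs) u@(_ ∷ uniq) = begin
  ∣ ⁅ x ⁆ ∪ listSet xs ∣        ≡⟨ ∣∪∣-disjoint ⁅ x ⁆ (listSet xs) x∉xs ⟩
  ∣ ⁅ x ⁆ ∣ + ∣ listSet xs ∣    ≡⟨ cong₂ _+_ (SP.∣⁅x⁆∣≡1 x) (∣listSet∣ xs uniq) ⟩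
  suc (length xs)               ∎
  where
  open ≡-Reasoning
  x∉xs : ∀ {z} → z ∈ₛ ⁅ x ⁆ → z ∉ₛ listSet xs
  x∉xs z∈x z∈xs with refl ← SP.x∈⁅y⁆⇒x≡y x z∈x = Unique[x∷xs]⇒x∉xs u (∈listSet⁻ xs z∈xs)

subsetOf : ∀ {n} {P : Fin n → Set} → Decidable P → Subset n
subsetOf P? = tabulate (λ i → does (P? i))

∈subsetOf⁺ : ∀ {n} {P : Fin n → Set} (P? : Decidable P) {i} → P i → i ∈ₛ subsetOf P?
∈subsetOf⁺ P? {i} Pi with P? i in eq
... | yes _ = VP.lookup⇒[]= i _ (trans (VP.lookup∘tabulate _ i) (cong does eq))
... | no ¬Pi = ⊥-elim (¬Pi Pi)

∈subsetOf⁻ : ∀ {n} {P : Fin n → Set} (P? : Decidable P) {i} → i ∈ₛ subsetOf P? → P i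
∈subsetOf⁻ P? {i} i∈ with P? i | trans (sym (VP.lookup∘tabulate _ i)) (VP.[]=⇒lookup i∈)
... | yes Pi | _ = Pi
... | no _   | ()

least : ∀ {n} {P : Fin n → Set} → Decidable P → ∀ {x} → P x →
        Σ (Fin n) λ m → P m × (∀ {z} → P z → m ≤ z)
least {suc n} P? {x} Px with P? Fin.zero
... | yes P0 = Fin.zero , P0 , λ _ → z≤n
least {suc n} P? {Fin.zero}  P0 | no ¬P0 = ⊥-elim (¬P0 P0)
least {suc n} P? {Fin.suc x} Px | no ¬P0 with least (λ j → P? (Fin.suc j)) Px
... | m , Pm , m≤ = Fin.suc m , Pm , λ { {Fin.zero} P0 → ⊥-elim (¬P0 P0) ; {Fin.suc z} Pz → s≤s (m≤ Pz) }

greatest : ∀ {n} {P : Fin n → Set} → Decidable P → ∀ {x} → P x →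
           Σ (Fin n) λ m → P m × (∀ {z} → P z → z ≤ m)
greatest {suc n} P? {x} Px with FP.any? (λ i → P? (Fin.suc i))
... | yes (i , Pi) with greatest (λ j → P? (Fin.suc j)) Pi
...   | m , Pm , ≤m = Fin.suc m , Pm , λ { {Fin.zero} _ → z≤n ; {Fin.suc z} Pz → s≤s (≤m Pz) }
greatest {suc n} P? {Fin.zero}  P0 | no ¬∃ =
  Fin.zero , P0 , λ { {Fin.zero} _ → z≤n ; {Fin.suc z} Pz → ⊥-elim (¬∃ (z , Pz)) }
greatest {suc n} P? {Fin.suc x} Px | no ¬∃ = ⊥-elim (¬∃ (x , Px))

squeeze : ∀ {n} {a z b : Fin n} → a ≤ z → z ≤ b → ¬ (a < z × z < b) → z ≡ a ⊎ z ≡ b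
squeeze {a = a} {z} {b} a≤z z≤b ¬inside with FP.<-cmp a z | FP.<-cmp z b
... | tri≈ _ a≡z _ | _            = inj₁ (sym a≡z)
... | tri> _ _ z<a | _            = ⊥-elim (ℕP.<⇒≱ z<a a≤z)
... | tri< a<z _ _ | tri< z<b _ _ = ⊥-elim (¬inside (a<z , z<b))
... | tri< _ _ _   | tri≈ _ z≡b _ = inj₂ z≡b
... | tri< _ _ _   | tri> _ _ b<z = ⊥-elim (ℕP.<⇒≱ b<z z≤b)

outside⇒<⊎> : ∀ {n} {a z b : Fin n} → ¬ (a ≤ z × z ≤ b) → z < a ⊎ b < z
outside⇒<⊎> {a = a} {z} {b} ¬within with a FP.≤? z | z FP.≤? b
... | no a≰z  | _       = inj₁ (ℕP.≰⇒> a≰z)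
... | yes _   | no z≰b  = inj₂ (ℕP.≰⇒> z≰b)
... | yes a≤z | yes z≤b = ⊥-elim (¬within (a≤z , z≤b))

gap : ∀ {n} (f : Subset n) {z s₁ s₂} → z ∉ₛ f → s₁ ∈ₛ f → s₁ < z → s₂ ∈ₛ f → z < s₂ →
      Σ (Fin n) λ u → Σ (Fin n) λ v → u ∈ₛ f × v ∈ₛ f × u < z × z < v ×
        (∀ w → w ∈ₛ f → ¬ (u < w × w < v))
gap f {z} z∉f s₁∈f s₁<z s₂∈f z<s₂
  with greatest (λ s → (s ∈? f) ×-dec (s FP.<? z)) (s₁∈f , s₁<z)
     | least    (λ s → (s ∈? f) ×-dec (z FP.<? s)) (s₂∈f , z<s₂)
... | u , (u∈f , u<z) , ≤u | v , (v∈f , z<v) , v≤ = u , v , u∈f , v∈f , u<z , z<v , nothing-between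
  where
  nothing-between : ∀ w → w ∈ₛ f → ¬ (u < w × w < v)
  nothing-between w w∈f (u<w , w<v) with FP.<-cmp w z
  ... | tri< w<z _ _ = ℕP.<⇒≱ u<w (≤u (w∈f , w<z))
  ... | tri≈ _ refl _ = z∉f w∈f
  ... | tri> _ _ z<w = ℕP.<⇒≱ w<v (v≤ (w∈f , z<w))

cost-filter : ∀ {n} {P : Subset n → Set} (P? : Decidable P) (V : List (Subset n)) →
              cost V ≡ cost (filter P? V) + cost (filter (λ f → ¬? (P? f)) V)
cost-filter P? []      = refl
cost-filter P? (f ∷ V) with P? f
... | yes _ = trans (cong (w f +_) (cost-filter P? V)) (sym (ℕP.+-assoc (w f) (cost (filter P? V)) _))
... | no  _ = trans (cong (w f +_) (cost-filter P? V)) (x∙yz≈y∙xz (w f) (cost (filter P? V)) _)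

unique-singleton : ∀ {A : Set} {a : A} {V : List A} → Unique V → (∀ {b} → b ∈ V → b ≡ a) → a ∈ V →
                   V ≡ a ∷ []
unique-singleton {V = b ∷ []}    _                    all≡a _ = cong (_∷ []) (all≡a (here refl))
unique-singleton {V = b ∷ c ∷ _} ((b≢c ∷ _) ∷ _) all≡a _ =
  ⊥-elim (b≢c (trans (all≡a (here refl)) (sym (all≡a (there (here refl))))))

cut-smaller : ∀ {a b m} → a + b ≡ m + 2 → 3 ℕ.≤ b → a ℕ.< m
cut-smaller {a} {b} {m} a+b≡m+2 b≥3 = ℕP.+-cancelʳ-≤ 2 (suc a) m (begin
  suc a + 2  ≡⟨ ℕP.+-suc a 2 ⟨
  a + 3      ≤⟨ ℕP.+-monoʳ-≤ a b≥3 ⟩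
  a + b      ≡⟨ a+b≡m+2 ⟩
  m + 2      ∎)
  where open ℕP.≤-Reasoning

cut-weights : ∀ {a b m} → a + b ≡ m + 2 → 3 ℕ.≤ a → 3 ℕ.≤ b → (a ∸ 2) + (b ∸ 2) ≡ m ∸ 2
cut-weights {suc (suc a)} {suc (suc b)} {m} a+b≡m+2 _ _ = begin
  a + b                 ≡⟨ ℕP.+-∸-assoc a {2 + b} (s≤s (s≤s z≤n)) ⟨
  (a + (2 + b)) ∸ 2     ≡⟨ cong (_∸ 2) m≡ ⟨
  m ∸ 2                 ∎
  where
  open ≡-Reasoning
  m≡ : m ≡ a + (2 + b)
  m≡ = ℕP.+-cancelʳ-≡ 2 m (a + (2 + b)) (trans (sym a+b≡m+2) (ℕP.+-comm 2 (a + (2 + b))))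
cut-weights {suc (suc _)} {suc zero} _ _ (s≤s ())
cut-weights {suc zero} _ (s≤s ()) _

side? : ∀ {n} (S : Subset n) x y → Dec (Side S x y)
side? S x y = FP.all? (λ z → (z ∈? S) →-dec ¬? ((x FP.<? z) ×-dec (z FP.<? y)))
       ⊎-dec FP.all? (λ z → (z ∈? S) →-dec ((x FP.≤? z) ×-dec (z FP.≤? y)))

¬side⇒inside : ∀ {n} {S : Subset n} {x y} → ¬ Side S x y → Σ (Fin n) λ z → z ∈ₛ S × x < z × z < y
¬side⇒inside {S = S} {x} {y} ¬side with FP.any? (λ z → (z ∈? S) ×-dec ((x FP.<? z) ×-dec (z FP.<? y)))
... | yes (z , z∈S , between) = z , z∈S , between
... | no ¬∃ = ⊥-elim (¬side (inj₁ λ z z∈S between → ¬∃ (z , z∈S , between)))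

¬within⇒outside : ∀ {n} {S : Subset n} {x y} → ¬ (∀ z → z ∈ₛ S → x ≤ z × z ≤ y) →
                  Σ (Fin n) λ z → z ∈ₛ S × (z < x ⊎ y < z)
¬within⇒outside {S = S} {x} {y} ¬within with FP.any? (λ z → (z ∈? S) ×-dec ¬? ((x FP.≤? z) ×-dec (z FP.≤? y)))
... | yes (z , z∈S , z∉xy) = z , z∈S , outside⇒<⊎> z∉xy
... | no ¬∃ = ⊥-elim (¬within λ z z∈S →
        decidable-stable ((x FP.≤? z) ×-dec (z FP.≤? y)) λ z∉xy → ¬∃ (z , z∈S , z∉xy))

¬side⇒outside : ∀ {n} {S : Subset n} {x y} → ¬ Side S x y → Σ (Fin n) λ z → z ∈ₛ S × (z < x ⊎ y < z)
¬side⇒outside ¬side = ¬within⇒outside (¬side ∘ inj₂)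

module _ {n} (G : OuterplanarGraph n) where

  Face : Subset n → Subset n → Set
  Face U = IsIntFace (_∈ₛ U) (inducedE G (_∈ₛ U))

  Polygon : Subset n → Set
  Polygon U = ∀ {x y} → x ∈ₛ U → y ∈ₛ U → x < y → Side U x y → E G x y

  crossing : ∀ {a b c d} → E G a b → E G c d → a < c → c < b → b < d → Empty
  crossing ab cd a<c c<b b<d = noncrossing G ab cd (a<c , c<b , b<d)

  module _ {U f : Subset n} (face : Face U f) where

    face⊆ : ∀ {z} → z ∈ₛ f → z ∈ₛ U
    face⊆ z∈f = proj₁ face _ z∈f

    face≥3 : 3 ℕ.≤ ∣ f ∣
    face≥3 = proj₁ (proj₂ face)

    side⇒edge : ∀ {a b} → a ∈ₛ f → b ∈ₛ f → a < b → Side f a b → E G a b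
    side⇒edge a∈f b∈f a<b side =
      proj₂ (proj₂ (Equivalence.from (proj₂ (proj₂ face) _ _ a∈f b∈f a<b) side))

    edge⇒side : ∀ {a b} → a ∈ₛ f → b ∈ₛ f → a < b → E G a b → Side f a b
    edge⇒side a∈f b∈f a<b ab =
      Equivalence.to (proj₂ (proj₂ face) _ _ a∈f b∈f a<b) (face⊆ a∈f , face⊆ b∈f , ab)

    -- A face has at least three vertices, so it is not squeezed onto the
    -- two endpoints of an interval.
    not-two-points : ∀ {a b} → (∀ {z} → z ∈ₛ f → a ≤ z × z ≤ b) →
                     ¬ (∀ {z} → z ∈ₛ f → ¬ (a < z × z < b))
    not-two-points within ¬inside = ℕP.<⇒≱ face≥3
      (⊆pair⇒∣∣≤2 λ z∈f → squeeze (proj₁ (within z∈f)) (proj₂ (within z∈f)) (¬inside z∈f))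

    some-vertex : Σ (Fin n) (_∈ₛ f)
    some-vertex with FP.any? (_∈? f)
    ... | yes ∃z = ∃z
    ... | no ¬∃z = ⊥-elim (ℕP.<⇒≱ face≥3 (ℕP.≤-trans ∣f∣≤0 z≤n))
      where
      ∣f∣≤0 : ∣ f ∣ ℕ.≤ 0
      ∣f∣≤0 = subst (∣ f ∣ ℕ.≤_) (SP.∣⊥∣≡0 n) (SP.p⊆q⇒∣p∣≤∣q∣ {q = ∅ {n}} λ {z} z∈f → ⊥-elim (¬∃z (z , z∈f)))

    -- The lowest and highest vertex of a face span its wrap-around side.
    record Span : Set where
      field
        lo hi     : Fin n
        lo∈f      : lo ∈ₛ f
        hi∈f      : hi ∈ₛ f
        within    : ∀ {z} → z ∈ₛ f → lo ≤ z × z ≤ hi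
        lo<hi     : lo < hi

    span : Span
    span with least (_∈? f) (proj₂ some-vertex) | greatest (_∈? f) (proj₂ some-vertex)
    ... | lo , lo∈f , lo≤ | hi , hi∈f , ≤hi = record
      { lo = lo ; hi = hi ; lo∈f = lo∈f ; hi∈f = hi∈f ; within = within ; lo<hi = lo<hi }
      where
      within : ∀ {z} → z ∈ₛ f → lo ≤ z × z ≤ hi
      within z∈f = lo≤ z∈f , ≤hi z∈f
      lo<hi : lo < hi
      lo<hi = decidable-stable (lo FP.<? hi) λ lo≮hi →
        not-two-points within λ _ (lo<z , z<hi) → lo≮hi (ℕP.<-trans lo<z z<hi)

  module _ {U f : Subset n} (face : Face U f) {x y} (x<y : x < y) (xy : E G x y)
           {p} (p∈f : p ∈ₛ f) (x<p : x < p) (p<y : p < y) where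
    open Span (span face)

    -- If x and y are vertices of f, xy is a side of f, excluding p or q.
    both-ends : x ∈ₛ f → y ∈ₛ f → ∀ {q} → q ∈ₛ f → q < x ⊎ y < q → Empty
    both-ends x∈f y∈f q∈f q-out with edge⇒side face x∈f y∈f x<y xy | q-out
    ... | inj₁ nothing-inside | _        = nothing-inside p p∈f (x<p , p<y)
    ... | inj₂ all-within     | inj₁ q<x = ℕP.<⇒≱ q<x (proj₁ (all-within _ q∈f))
    ... | inj₂ all-within     | inj₂ y<q = ℕP.<⇒≱ y<q (proj₂ (all-within _ q∈f))

    -- A side uv of f with u < x < v crosses xy.
    gap-below : x ∉ₛ f → ∀ {s} → s ∈ₛ f → s < x → Empty
    gap-below x∉f s∈f s<x with gap f x∉f s∈f s<x p∈f x<p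
    ... | u , v , u∈f , v∈f , u<x , x<v , between =
      crossing (side⇒edge face u∈f v∈f (ℕP.<-trans u<x x<v) (inj₁ between)) xy u<x x<v
               (ℕP.≤-<-trans (ℕP.≮⇒≥ λ p<v → between p p∈f (ℕP.<-trans u<x x<p , p<v)) p<y)

    -- A side uv of f with u < y < v crosses xy.
    gap-above : y ∉ₛ f → ∀ {s} → s ∈ₛ f → y < s → Empty
    gap-above y∉f s∈f y<s with gap f y∉f p∈f p<y s∈f y<s
    ... | u , v , u∈f , v∈f , u<y , y<v , between =
      crossing xy (side⇒edge face u∈f v∈f (ℕP.<-trans u<y y<v) (inj₁ between))
               (ℕP.<-≤-trans x<p (ℕP.≮⇒≥ λ u<p → between p p∈f (u<p , ℕP.<-trans p<y y<v))) u<y y<v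

    -- If f lies below y, its wrap-around side lo–hi has lo < x < hi < y.
    wrap-below : y ∉ₛ f → (∀ {s} → s ∈ₛ f → ¬ y < s) → ∀ {q} → q ∈ₛ f → q < x → Empty
    wrap-below y∉f ¬above q∈f q<x = crossing wrap xy lo<x x<hi hi<y
      where
      lo<x = ℕP.≤-<-trans (proj₁ (within q∈f)) q<x
      x<hi = ℕP.<-≤-trans x<p (proj₂ (within p∈f))
      hi<y = FP.≤∧≢⇒< (ℕP.≮⇒≥ (¬above hi∈f)) λ { refl → y∉f hi∈f }
      wrap = side⇒edge face lo∈f hi∈f lo<hi (inj₂ λ _ → within)

    -- If f lies above x, its wrap-around side lo–hi has x < lo < y < hi.
    wrap-above : x ∉ₛ f → (∀ {s} → s ∈ₛ f → ¬ s < x) → ∀ {q} → q ∈ₛ f → y < q → Empty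
    wrap-above x∉f ¬below q∈f y<q = crossing xy wrap x<lo lo<y y<hi
      where
      y<hi = ℕP.<-≤-trans y<q (proj₂ (within q∈f))
      lo<y = ℕP.≤-<-trans (proj₁ (within p∈f)) p<y
      x<lo = FP.≤∧≢⇒< (ℕP.≮⇒≥ (¬below lo∈f)) λ { refl → x∉f lo∈f }
      wrap = side⇒edge face lo∈f hi∈f lo<hi (inj₂ λ _ → within)

    face-one-side : ∀ {q} → q ∈ₛ f → q < x ⊎ y < q → Empty
    face-one-side q∈f (inj₁ q<x) with x ∈? f | y ∈? f
    ... | no x∉f  | _       = gap-below x∉f q∈f q<x
    ... | yes x∈f | yes y∈f = both-ends x∈f y∈f q∈f (inj₁ q<x)
    ... | yes _   | no y∉f with FP.any? (λ s → (s ∈? f) ×-dec (y FP.<? s))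
    ...   | yes (s , s∈f , y<s) = gap-above y∉f s∈f y<s
    ...   | no ¬above           = wrap-below y∉f (λ s∈f y<s → ¬above (_ , s∈f , y<s)) q∈f q<x
    face-one-side q∈f (inj₂ y<q) with y ∈? f | x ∈? f
    ... | no y∉f  | _       = gap-above y∉f q∈f y<q
    ... | yes y∈f | yes x∈f = both-ends x∈f y∈f q∈f (inj₂ y<q)
    ... | yes _   | no x∉f with FP.any? (λ s → (s ∈? f) ×-dec (s FP.<? x))
    ...   | yes (s , s∈f , s<x) = gap-below x∉f s∈f s<x
    ...   | no ¬below           = wrap-above x∉f (λ s∈f s<x → ¬below (_ , s∈f , s<x)) q∈f y<q

  -- A face of U restricted to a smaller vertex set containing it is still a
  -- face there, and a face of a smaller vertex set U′ ⊆ U is a face of U: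
  -- being a face only depends on the edges among the face's own vertices.
  face-restrict : ∀ {U U′ f} → Face U f → f ⊆ U′ → Face U′ f
  face-restrict face f⊆U′ = (λ _ → f⊆U′) , face≥3 face , λ a b a∈f b∈f a<b → mk⇔
    (λ (_ , _ , ab) → edge⇒side face a∈f b∈f a<b ab)
    (λ side → f⊆U′ a∈f , f⊆U′ b∈f , side⇒edge face a∈f b∈f a<b side)

  face-extend : ∀ {U U′ f} → U′ ⊆ U → Face U′ f → Face U f
  face-extend U′⊆U face = face-restrict face (λ z∈f → U′⊆U (face⊆ face z∈f))

  record Chord (U : Subset n) : Set where
    constructor chord
    field
      {x y} : Fin n
      x∈U   : x ∈ₛ U
      y∈U   : y ∈ₛ U
      x<y   : x < y
      edge  : E G x y
      ¬side : ¬ Side U x y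

  module _ {U : Subset n} (¬chord : ¬ Chord U) where

    edge⇒side-of-U : ∀ {x y} → x ∈ₛ U → y ∈ₛ U → x < y → E G x y → Side U x y
    edge⇒side-of-U x∈U y∈U x<y xy =
      decidable-stable (side? U _ _) λ ¬side → ¬chord (chord x∈U y∈U x<y xy ¬side)

    U-is-face : 3 ℕ.≤ ∣ U ∣ → Polygon U → Face U U
    U-is-face U≥3 polygon = (λ _ u∈U → u∈U) , U≥3 , λ x y x∈U y∈U x<y → mk⇔
      (λ (_ , _ , xy) → edge⇒side-of-U x∈U y∈U x<y xy)
      (λ side → x∈U , y∈U , polygon x∈U y∈U x<y side)

    module _ {f : Subset n} (face : Face U f) where
      open Span (span face)

      wrap-spans-U : ∀ {u} → u ∈ₛ U → lo ≤ u × u ≤ hi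
      wrap-spans-U u∈U with edge⇒side-of-U (face⊆ face lo∈f) (face⊆ face hi∈f) lo<hi
                              (side⇒edge face lo∈f hi∈f lo<hi (inj₂ λ _ → within))
      ... | inj₂ U-within    = U-within _ u∈U
      ... | inj₁ none-inside = ⊥-elim (not-two-points face within λ z∈f → none-inside _ (face⊆ face z∈f))

      -- Every vertex of U is a vertex of f: otherwise the side of f around
      -- it would be an edge with a vertex of U strictly inside, i.e. a chord.
      U⊆face : U ⊆ f
      U⊆face {u} u∈U = decidable-stable (u ∈? f) λ u∉f →
        let lo≤u , u≤hi = wrap-spans-U u∈U
            lo<u = FP.≤∧≢⇒< lo≤u λ { refl → u∉f lo∈f }
            u<hi = FP.≤∧≢⇒< u≤hi λ { refl → u∉f hi∈f }
            a , b , a∈f , b∈f , a<u , u<b , between = gap f u∉f lo∈f lo<u hi∈f u<hi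
            a<b = ℕP.<-trans a<u u<b
        in case edge⇒side-of-U (face⊆ face a∈f) (face⊆ face b∈f) a<b
                  (side⇒edge face a∈f b∈f a<b (inj₁ between)) of λ where
             (inj₁ none-inside) → none-inside u u∈U (a<u , u<b)
             (inj₂ U-within) → not-two-points face (λ z∈f → U-within _ (face⊆ face z∈f)) (between _)

      face≡U : f ≡ U
      face≡U = SP.⊆-antisym (face⊆ face) U⊆face

  Lists : Subset n → List (Subset n) → Set
  Lists U V = Unique V × (∀ f → f ∈ V ⇔ Face U f)

  lists-filter : ∀ {U U′ V} {P : Subset n → Set} (P? : Decidable P) → Lists U V →
                 (∀ {f} → Face U′ f → Face U f × P f) → (∀ {f} → Face U f → P f → Face U′ f) →
                 Lists U′ (filter P? V)
  lists-filter P? (unique , V⇔) ⇒U,P U,P⇒ = filter⁺ P? unique , λ f → mk⇔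
    (λ f∈ → let f∈V , Pf = ∈-filter⁻ P? f∈ in U,P⇒ (Equivalence.to (V⇔ f) f∈V) Pf)
    (λ face′ → let face , Pf = ⇒U,P face′ in ∈-filter⁺ P? (Equivalence.from (V⇔ f) face) Pf)

  module Cut {U : Subset n} (polygon : Polygon U) (c : Chord U) where
    open Chord c

    InU₁ : Fin n → Set
    InU₁ i = i ∈ₛ U × (x ≤ i × i ≤ y)

    InU₂ : Fin n → Set
    InU₂ i = i ∈ₛ U × ¬ (x < i × i < y)

    inU₁? : Decidable InU₁
    inU₁? i = (i ∈? U) ×-dec ((x FP.≤? i) ×-dec (i FP.≤? y))

    inU₂? : Decidable InU₂
    inU₂? i = (i ∈? U) ×-dec ¬? ((x FP.<? i) ×-dec (i FP.<? y))

    U₁ U₂ : Subset n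
    U₁ = subsetOf inU₁?
    U₂ = subsetOf inU₂?

    U₁⊆U : U₁ ⊆ U
    U₁⊆U z∈ = proj₁ (∈subsetOf⁻ inU₁? z∈)

    U₂⊆U : U₂ ⊆ U
    U₂⊆U z∈ = proj₁ (∈subsetOf⁻ inU₂? z∈)

    x∈U₁ : x ∈ₛ U₁
    x∈U₁ = ∈subsetOf⁺ inU₁? (x∈U , FP.≤-refl , ℕP.<⇒≤ x<y)

    y∈U₁ : y ∈ₛ U₁
    y∈U₁ = ∈subsetOf⁺ inU₁? (y∈U , ℕP.<⇒≤ x<y , FP.≤-refl)

    x∈U₂ : x ∈ₛ U₂
    x∈U₂ = ∈subsetOf⁺ inU₂? (x∈U , λ (x<x , _) → FP.<-irrefl refl x<x)

    y∈U₂ : y ∈ₛ U₂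
    y∈U₂ = ∈subsetOf⁺ inU₂? (y∈U , λ (_ , y<y) → FP.<-irrefl refl y<y)

    U₁∪U₂≡U : U₁ ∪ U₂ ≡ U
    U₁∪U₂≡U = SP.⊆-antisym
      (λ z∈ → [ U₁⊆U , U₂⊆U ] (SP.x∈p∪q⁻ U₁ U₂ z∈))
      (λ {z} z∈U → SP.x∈p∪q⁺ (case (x FP.≤? z) ×-dec (z FP.≤? y) of λ where
        (yes within) → inj₁ (∈subsetOf⁺ inU₁? (z∈U , within))
        (no ¬within) → inj₂ (∈subsetOf⁺ inU₂? (z∈U , λ (x<z , z<y) → ¬within (ℕP.<⇒≤ x<z , ℕP.<⇒≤ z<y)))))

    U₁∩U₂≡xy : U₁ ∩ U₂ ≡ pair x y
    U₁∩U₂≡xy = SP.⊆-antisym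
      (λ z∈ → let z∈₁ , z∈₂ = SP.x∈p∩q⁻ U₁ U₂ z∈
                  _ , x≤z , z≤y = ∈subsetOf⁻ inU₁? z∈₁
              in ∈pair⁺ (squeeze x≤z z≤y (proj₂ (∈subsetOf⁻ inU₂? z∈₂))))
      (λ z∈xy → SP.x∈p∩q⁺ (case ∈pair⁻ z∈xy of λ where
        (inj₁ refl) → x∈U₁ , x∈U₂
        (inj₂ refl) → y∈U₁ , y∈U₂))

    ∣U₁∣+∣U₂∣ : ∣ U₁ ∣ + ∣ U₂ ∣ ≡ ∣ U ∣ + 2
    ∣U₁∣+∣U₂∣ = begin
      ∣ U₁ ∣ + ∣ U₂ ∣             ≡⟨ ∣∪∣+∣∩∣ U₁ U₂ ⟨
      ∣ U₁ ∪ U₂ ∣ + ∣ U₁ ∩ U₂ ∣   ≡⟨ cong₂ (λ p q → ∣ p ∣ + ∣ q ∣) U₁∪U₂≡U U₁∩U₂≡xy ⟩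
      ∣ U ∣ + ∣ pair x y ∣        ≡⟨ cong (∣ U ∣ +_) (∣pair∣≡2 (FP.<⇒≢ x<y)) ⟩
      ∣ U ∣ + 2                   ∎
      where open ≡-Reasoning

    -- Each part has a third vertex, as xy is not a side of U.
    ∣U₁∣≥3 : 3 ℕ.≤ ∣ U₁ ∣
    ∣U₁∣≥3 with ¬side⇒inside ¬side
    ... | z , z∈U , x<z , z<y = three≤∣∣ x∈U₁ y∈U₁ (∈subsetOf⁺ inU₁? (z∈U , ℕP.<⇒≤ x<z , ℕP.<⇒≤ z<y))
                                  (FP.<⇒≢ x<y) (FP.<⇒≢ x<z) (λ { refl → FP.<-irrefl refl z<y })

    ∣U₂∣≥3 : 3 ℕ.≤ ∣ U₂ ∣
    ∣U₂∣≥3 with ¬side⇒outside ¬side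
    ... | z , z∈U , inj₁ z<x = three≤∣∣ x∈U₂ y∈U₂ (∈subsetOf⁺ inU₂? (z∈U , λ (x<z , _) → ℕP.<-asym x<z z<x))
                                 (FP.<⇒≢ x<y) (λ { refl → FP.<-irrefl refl z<x }) (λ { refl → ℕP.<-asym x<y z<x })
    ... | z , z∈U , inj₂ y<z = three≤∣∣ x∈U₂ y∈U₂ (∈subsetOf⁺ inU₂? (z∈U , λ (_ , z<y) → ℕP.<-asym y<z z<y))
                                 (FP.<⇒≢ x<y) (FP.<⇒≢ (ℕP.<-trans x<y y<z)) (FP.<⇒≢ y<z)

    -- Both parts are polygons: a side of a part is a side of U or the chord.
    polygon₁ : Polygon U₁
    polygon₁ {a} {b} a∈ b∈ a<b (inj₁ none-between) = polygon (U₁⊆U a∈) (U₁⊆U b∈) a<b (inj₁ λ z z∈U (a<z , z<b) →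
      let _ , x≤a , _ = ∈subsetOf⁻ inU₁? a∈
          _ , _ , b≤y = ∈subsetOf⁻ inU₁? b∈
      in none-between z (∈subsetOf⁺ inU₁? (z∈U , ℕP.<⇒≤ (ℕP.≤-<-trans x≤a a<z) , ℕP.<⇒≤ (ℕP.<-≤-trans z<b b≤y)))
                      (a<z , z<b))
    polygon₁ {a} {b} a∈ b∈ a<b (inj₂ U₁-within) = subst₂ (E G) (sym a≡x) (sym b≡y) edge
      where
      a≡x = FP.≤-antisym (proj₁ (U₁-within x x∈U₁)) (proj₁ (proj₂ (∈subsetOf⁻ inU₁? a∈)))
      b≡y = FP.≤-antisym (proj₂ (proj₂ (∈subsetOf⁻ inU₁? b∈))) (proj₂ (U₁-within y y∈U₁))

    polygon₂ : Polygon U₂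
    polygon₂ {a} {b} a∈ b∈ a<b (inj₂ U₂-within) = polygon (U₂⊆U a∈) (U₂⊆U b∈) a<b (inj₂ λ z z∈U →
      case (x FP.<? z) ×-dec (z FP.<? y) of λ where
        (yes (x<z , z<y)) → ℕP.<⇒≤ (ℕP.≤-<-trans (proj₁ (U₂-within x x∈U₂)) x<z)
                          , ℕP.<⇒≤ (ℕP.<-≤-trans z<y (proj₂ (U₂-within y y∈U₂)))
        (no ¬between) → U₂-within z (∈subsetOf⁺ inU₂? (z∈U , ¬between)))
    polygon₂ {a} {b} a∈ b∈ a<b (inj₁ none-between) with b FP.≤? x | y FP.≤? a
    ... | yes b≤x | _ = polygon (U₂⊆U a∈) (U₂⊆U b∈) a<b (inj₁ λ z z∈U (a<z , z<b) →
          none-between z (∈subsetOf⁺ inU₂? (z∈U , λ (x<z , _) → ℕP.<-asym (ℕP.<-≤-trans z<b b≤x) x<z)) (a<z , z<b))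
    ... | no _ | yes y≤a = polygon (U₂⊆U a∈) (U₂⊆U b∈) a<b (inj₁ λ z z∈U (a<z , z<b) →
          none-between z (∈subsetOf⁺ inU₂? (z∈U , λ (_ , z<y) → ℕP.<-asym (ℕP.≤-<-trans y≤a a<z) z<y)) (a<z , z<b))
    ... | no b≰x | no y≰a = subst₂ (E G) (sym a≡x) (sym b≡y) edge
      where
      x<b = ℕP.≰⇒> b≰x
      a<y = ℕP.≰⇒> y≰a
      a≤x = ℕP.≮⇒≥ λ x<a → proj₂ (∈subsetOf⁻ inU₂? a∈) (x<a , a<y)
      y≤b = ℕP.≮⇒≥ λ b<y → proj₂ (∈subsetOf⁻ inU₂? b∈) (x<b , b<y)
      a≡x = decidable-stable (a FP.≟ x) λ a≢x → none-between x x∈U₂ (FP.≤∧≢⇒< a≤x a≢x , x<b)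
      b≡y = decidable-stable (b FP.≟ y) λ b≢y → none-between y y∈U₂ (a<y , FP.≤∧≢⇒< y≤b (b≢y ∘ sym))

    InsideChord : Subset n → Set
    InsideChord f = ∀ z → z ∈ₛ f → x ≤ z × z ≤ y

    insideChord? : Decidable InsideChord
    insideChord? f = FP.all? λ z → (z ∈? f) →-dec ((x FP.≤? z) ×-dec (z FP.≤? y))

    face₁⇒ : ∀ {f} → Face U₁ f → Face U f × InsideChord f
    face₁⇒ face = face-extend U₁⊆U face , λ z z∈f → proj₂ (∈subsetOf⁻ inU₁? (face⊆ face z∈f))

    ⇒face₁ : ∀ {f} → Face U f → InsideChord f → Face U₁ f
    ⇒face₁ face in-chord = face-restrict face λ z∈f → ∈subsetOf⁺ inU₁? (face⊆ face z∈f , in-chord _ z∈f)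

    face₂⇒ : ∀ {f} → Face U₂ f → Face U f × ¬ InsideChord f
    face₂⇒ face = face-extend U₂⊆U face , λ in-chord →
      not-two-points face (in-chord _) λ z∈f → proj₂ (∈subsetOf⁻ inU₂? (face⊆ face z∈f))

    -- A face of U with a vertex outside [x, y] has none inside (x, y).
    ⇒face₂ : ∀ {f} → Face U f → ¬ InsideChord f → Face U₂ f
    ⇒face₂ {f} face ¬inside =
      let q , q∈f , q-outside = ¬within⇒outside ¬inside
      in face-restrict face λ z∈f → ∈subsetOf⁺ inU₂? (face⊆ face z∈f , λ (x<z , z<y) →
           face-one-side face x<y edge z∈f x<z z<y q∈f q-outside)

    lists₁ : ∀ {V} → Lists U V → Lists U₁ (filter insideChord? V)
    lists₁ lists = lists-filter insideChord? lists face₁⇒ ⇒face₁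

    lists₂ : ∀ {V} → Lists U V → Lists U₂ (filter (λ f → ¬? (insideChord? f)) V)
    lists₂ lists = lists-filter (λ f → ¬? (insideChord? f)) lists face₂⇒ ⇒face₂

  -- Edges of G are not decidable, so the existence of a chord is only decided
  -- under double negation; this suffices as the claim is a decidable equation.
  polygon-cost-acc : ∀ {U} → Acc ℕ._<_ ∣ U ∣ → 3 ℕ.≤ ∣ U ∣ → Polygon U →
                     ∀ {V} → Lists U V → cost V ≡ ∣ U ∣ ∸ 2
  polygon-cost-acc {U} (acc smaller) U≥3 polygon {V} lists =
    decidable-stable (cost V ℕP.≟ ∣ U ∣ ∸ 2) λ cost≢ → ¬¬-excluded-middle λ where
      (yes c)  → cost≢ (with-chord c)
      (no ¬c) → cost≢ (chordless ¬c)
    where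
    chordless : ¬ Chord U → cost V ≡ ∣ U ∣ ∸ 2
    chordless ¬c = begin
      cost V         ≡⟨ cong cost V≡[U] ⟩
      ∣ U ∣ ∸ 2 + 0  ≡⟨ ℕP.+-identityʳ _ ⟩
      ∣ U ∣ ∸ 2      ∎
      where
      open ≡-Reasoning
      V≡[U] : V ≡ U ∷ []
      V≡[U] = unique-singleton (proj₁ lists)
        (λ {f} f∈V → face≡U ¬c (Equivalence.to (proj₂ lists f) f∈V))
        (Equivalence.from (proj₂ lists U) (U-is-face ¬c U≥3 polygon))

    with-chord : Chord U → cost V ≡ ∣ U ∣ ∸ 2
    with-chord c = begin
      cost V                       ≡⟨ cost-filter insideChord? V ⟩
      cost V₁ + cost V₂            ≡⟨ cong₂ _+_ cost₁ cost₂ ⟩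
      (∣ U₁ ∣ ∸ 2) + (∣ U₂ ∣ ∸ 2)  ≡⟨ cut-weights ∣U₁∣+∣U₂∣ ∣U₁∣≥3 ∣U₂∣≥3 ⟩
      ∣ U ∣ ∸ 2                    ∎
      where
      open Cut polygon c
      open ≡-Reasoning
      V₁ = filter insideChord? V
      V₂ = filter (λ f → ¬? (insideChord? f)) V
      ∣U₁∣<∣U∣ = cut-smaller ∣U₁∣+∣U₂∣ ∣U₂∣≥3
      ∣U₂∣<∣U∣ = cut-smaller (trans (ℕP.+-comm ∣ U₂ ∣ ∣ U₁ ∣) ∣U₁∣+∣U₂∣) ∣U₁∣≥3
      cost₁ : cost V₁ ≡ ∣ U₁ ∣ ∸ 2
      cost₁ = polygon-cost-acc (smaller ∣U₁∣<∣U∣) ∣U₁∣≥3 polygon₁ (lists₁ lists)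
      cost₂ : cost V₂ ≡ ∣ U₂ ∣ ∸ 2
      cost₂ = polygon-cost-acc (smaller ∣U₂∣<∣U∣) ∣U₂∣≥3 polygon₂ (lists₂ lists)

  polygon-cost : ∀ {U} → 3 ℕ.≤ ∣ U ∣ → Polygon U → ∀ {V} → Lists U V → cost V ≡ ∣ U ∣ ∸ 2
  polygon-cost {U} = polygon-cost-acc (<-wellFounded ∣ U ∣)

reach-snoc : ∀ {n} {R : Fin n → Fin n → Set} {A : Fin n → Set} {x y z} →
             Reach R A x y → R y z → A z → Reach R A x z
reach-snoc (here Ax)          xz Az = there Ax xz (here Az)
reach-snoc (there Ax xy rest) yz Az = there Ax xy (reach-snoc rest yz Az)

reach-reverse : ∀ {n} {R : Fin n → Fin n → Set} {A : Fin n → Set} → (∀ {x y} → R x y → R y x) →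
                ∀ {x y} → Reach R A x y → Reach R A y x
reach-reverse sym-R (here Ax)          = here Ax
reach-reverse sym-R (there Ax xy rest) = reach-snoc (reach-reverse sym-R rest) (sym-R xy) Ax

reach-start : ∀ {n} {R : Fin n → Fin n → Set} {A : Fin n → Set} {x y} → Reach R A x y → A x
reach-start (here Ax)       = Ax
reach-start (there Ax _ _)  = Ax

linked⇒reach : ∀ {n} {R : Fin n → Fin n → Set} {A : Fin n → Set} x xs {z} →
               Linked R (x ∷ xs ++ z ∷ []) → (∀ {y} → y ∈ x ∷ xs ++ z ∷ [] → A y) → Reach R A x z
linked⇒reach x []       (xz ∷ [-]) allowed =
  there (allowed (here refl)) xz (here (allowed (there (here refl))))
linked⇒reach x (y ∷ ys) (xy ∷ l)   allowed =
  there (allowed (here refl)) xy (linked⇒reach y ys l (allowed ∘ there))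

closed : ∀ {A : Set} → List A → List A
closed []       = []
closed (x ∷ xs) = x ∷ xs ++ x ∷ []

module _ {A : Set} {R : A → A → Set} where

  linked-split : ∀ xs {z ys} → Linked R (xs ++ z ∷ ys) → Linked R (xs ++ z ∷ []) × Linked R (z ∷ ys)
  linked-split []            l        = [-] , l
  linked-split (x ∷ [])      (r ∷ l)  = (r ∷ [-]) , l
  linked-split (x ∷ x′ ∷ xs) (r ∷ l)  = let l₁ , l₂ = linked-split (x′ ∷ xs) l in (r ∷ l₁) , l₂

  linked-join : ∀ xs {z ys} → Linked R (xs ++ z ∷ []) → Linked R (z ∷ ys) → Linked R (xs ++ z ∷ ys)
  linked-join []            _        l = l
  linked-join (x ∷ [])      (r ∷ _)  l = r ∷ l
  linked-join (x ∷ x′ ∷ xs) (r ∷ l₁) l = r ∷ linked-join (x′ ∷ xs) l₁ l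

  rotate-closed : ∀ X a Y → Linked R (closed (X ++ a ∷ Y)) → Linked R (closed (a ∷ Y ++ X))
  rotate-closed []       a Y l = subst (λ W → Linked R (a ∷ W ++ a ∷ [])) (sym (LP.++-identityʳ Y)) l
  rotate-closed (x ∷ X′) a Y l =
    let l₁ , l₂ = linked-split (x ∷ X′) (subst (Linked R) (cong (x ∷_) (LP.++-assoc X′ (a ∷ Y) (x ∷ []))) l)
    in subst (Linked R) (cong (a ∷_) (sym (LP.++-assoc Y (x ∷ X′) (a ∷ [])))) (linked-join (a ∷ Y) l₂ l₁)

module _ {A : Set} where

  unique-++⁻ : ∀ (xs : List A) {ys} → Unique (xs ++ ys) →
               Unique xs × Unique ys × (∀ {z} → z ∈ xs → z ∉ ys)
  unique-++⁻ []       u        = [] , u , λ ()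
  unique-++⁻ (x ∷ xs) (x∉ ∷ u) =
    let uxs , uys , disjoint = unique-++⁻ xs u
        x∉xs , x∉ys = AllP.++⁻ xs x∉
    in (x∉xs ∷ uxs) , uys , λ where
         (here refl) z∈ys → All.lookup x∉ys z∈ys refl
         (there z∈xs)     → disjoint z∈xs

  rotate-unique : ∀ X (a : A) Y → Unique (X ++ a ∷ Y) → Unique (a ∷ Y ++ X)
  rotate-unique X a Y u =
    let uX , uaY , disjoint = unique-++⁻ X u
    in UniqueP.++⁺ uaY uX λ (z∈aY , z∈X) → disjoint z∈X z∈aY

  rotate-∈ : ∀ X (a : A) Y {z} → z ∈ Y ++ X → z ∈ X ++ a ∷ Y
  rotate-∈ X a Y z∈ with ∈-++⁻ Y z∈
  ... | inj₁ z∈Y = ∈-++⁺ʳ X (there z∈Y)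
  ... | inj₂ z∈X = ∈-++⁺ˡ z∈X

module _ {n} (G : OuterplanarGraph n) where

  Between : Fin n → Fin n → Fin n → Set
  Between u v z = u < z × z < v

  Avoid : Fin n → Fin n → Fin n → Set
  Avoid u v z = z ≢ u × z ≢ v

  -- An edge leaving (u, v) through neither u nor v would cross the edge uv.
  edge-stays-between : ∀ {u v s t} → E G u v → E G s t → Avoid u v t → Between u v s → Between u v t
  edge-stays-between {u} {v} {s} {t} uv st (t≢u , t≢v) (u<s , s<v) with FP.<-cmp t u | FP.<-cmp t v
  ... | tri< t<u _ _ | _            = ⊥-elim (crossing G (E-sym G st) uv t<u u<s s<v)
  ... | tri≈ _ t≡u _ | _            = ⊥-elim (t≢u t≡u)
  ... | tri> _ _ u<t | tri< t<v _ _ = u<t , t<v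
  ... | tri> _ _ _   | tri≈ _ t≡v _ = ⊥-elim (t≢v t≡v)
  ... | tri> _ _ _   | tri> _ _ v<t = ⊥-elim (crossing G uv st u<s s<v v<t)

  path-stays : ∀ {u v} {A : Fin n → Set} → E G u v → (∀ {z} → A z → Avoid u v z) →
               ∀ {s t} → Reach (E G) A s t → Between u v s ⇔ Between u v t
  path-stays uv avoid (here _)            = mk⇔ (λ s-in → s-in) (λ s-in → s-in)
  path-stays uv avoid (there As st rest) = mk⇔
    (λ s-in → Equivalence.to rest-stays (edge-stays-between uv st (avoid (reach-start rest)) s-in))
    (λ t-in → edge-stays-between uv (E-sym G st) (avoid As) (Equivalence.from rest-stays t-in))
    where rest-stays = path-stays uv avoid rest

  -- Let ab be a side of U and r < r′ two further vertices of U adjacent to a.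
  -- Then r and r′ cannot be joined to b by paths avoiding a and the other one:
  -- in each position of r and r′ relative to a and b, one of these paths
  -- would have to leave the region cut off by the edge ar or ar′.
  module _ {U : Subset n} {a b r r′} (a<b : a < b) (side : Side U a b) (r<r′ : r < r′)
           (r∈U : r ∈ₛ U) (r′∈U : r′ ∈ₛ U) (r∉ab : Avoid a b r) (r′∉ab : Avoid a b r′)
           (ar : E G a r) (ar′ : E G a r′)
           (arc : Reach (E G) (Avoid a r′) r b) (arc′ : Reach (E G) (Avoid a r) r′ b) where

    swap : ∀ {u v z} → Avoid u v z → Avoid v u z
    swap (z≢u , z≢v) = z≢v , z≢u

    open-inside : ∀ {z} → Avoid a b z → a ≤ z × z ≤ b → Between a b z
    open-inside (z≢a , z≢b) (a≤z , z≤b) = FP.≤∧≢⇒< a≤z (z≢a ∘ sym) , FP.≤∧≢⇒< z≤b z≢b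

    open-outside : ∀ {z} → Avoid a b z → ¬ Between a b z → z < a ⊎ b < z
    open-outside z∉ab ¬between = outside⇒<⊎> (¬between ∘ open-inside z∉ab)

    -- r and r′ outside [a, b]: the edge ar or ar′ separates the ends of an arc.
    arcs-outside : r < a ⊎ b < r → r′ < a ⊎ b < r′ → Empty
    arcs-outside (inj₁ r<a) (inj₁ r′<a) =
      ℕP.<-asym a<b (proj₂ (Equivalence.to (path-stays (E-sym G ar) swap arc′) (r<r′ , r′<a)))
    arcs-outside (inj₁ r<a) (inj₂ b<r′) =
      ℕP.<-asym r<a (proj₁ (Equivalence.from (path-stays ar′ (λ av → av) arc) (a<b , b<r′)))
    arcs-outside (inj₂ b<r) (inj₁ r′<a) =
      ℕP.<-asym r<r′ (ℕP.<-trans r′<a (ℕP.<-trans a<b b<r))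
    arcs-outside (inj₂ b<r) (inj₂ _) =
      ℕP.<-asym r<r′ (proj₂ (Equivalence.from (path-stays ar (λ av → av) arc′) (a<b , b<r)))

    -- r and r′ inside (a, b): the edge ar′ separates r from b.
    arcs-inside : Between a b r → Between a b r′ → Empty
    arcs-inside (a<r , _) (_ , r′<b) =
      ℕP.<-asym r′<b (proj₂ (Equivalence.to (path-stays ar′ (λ av → av) arc) (a<r , r<r′)))

    no-two-arcs : Empty
    no-two-arcs = [ (λ none-between → arcs-outside (open-outside r∉ab (none-between r r∈U))
                                                   (open-outside r′∉ab (none-between r′ r′∈U)))
                  , (λ within → arcs-inside (open-inside r∉ab (within r r∈U))
                                            (open-inside r′∉ab (within r′ r′∈U)))
                  ] side

  two-arcs-impossible : ∀ {U : Subset n} {a b r r′} → a < b → Side U a b → r ≢ r′ →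
                        r ∈ₛ U → r′ ∈ₛ U → Avoid a b r → Avoid a b r′ → E G a r → E G a r′ →
                        Reach (E G) (Avoid a r′) r b → Reach (E G) (Avoid a r) r′ b → Empty
  two-arcs-impossible {r = r} {r′} a<b side r≢r′ r∈U r′∈U r∉ab r′∉ab ar ar′ arc arc′ with FP.<-cmp r r′
  ... | tri< r<r′ _ _ = no-two-arcs a<b side r<r′ r∈U r′∈U r∉ab r′∉ab ar ar′ arc arc′
  ... | tri≈ _ r≡r′ _ = r≢r′ r≡r′
  ... | tri> _ _ r′<r = no-two-arcs a<b side r′<r r′∈U r∈U r′∉ab r∉ab ar′ ar arc′ arc

  -- A cycle a r P b Q₀ r′ through U (closing back to a): the neighbours r and
  -- r′ of a are joined to b by the arcs r P b and b Q₀ r′, which avoid a and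
  -- each other's start, so ab cannot be a side of U.
  module CycleThrough {U : Subset n} {a b r r′} (P Q₀ : List (Fin n))
           (unique : Unique (a ∷ r ∷ P ++ b ∷ Q₀ ++ r′ ∷ []))
           (linked : Linked (E G) (closed (a ∷ r ∷ P ++ b ∷ Q₀ ++ r′ ∷ [])))
           (⊆U : ∀ {z} → z ∈ r ∷ P ++ b ∷ Q₀ ++ r′ ∷ [] → z ∈ₛ U) where

    W : List (Fin n)
    W = r ∷ P ++ b ∷ Q₀ ++ r′ ∷ []

    halves : Linked (E G) (a ∷ r ∷ P ++ b ∷ []) × Linked (E G) (b ∷ (Q₀ ++ r′ ∷ []) ++ a ∷ [])
    halves = linked-split (a ∷ r ∷ P)
      (subst (Linked (E G)) (cong (λ l → a ∷ r ∷ l) (LP.++-assoc P (b ∷ Q₀ ++ r′ ∷ []) (a ∷ []))) linked)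

    closing : Linked (E G) (b ∷ Q₀ ++ r′ ∷ []) × Linked (E G) (r′ ∷ a ∷ [])
    closing = linked-split (b ∷ Q₀)
      (subst (Linked (E G)) (cong (b ∷_) (LP.++-assoc Q₀ (r′ ∷ []) (a ∷ []))) (proj₂ halves))

    ≢a : ∀ {z} → z ∈ W → z ≢ a
    ≢a z∈W refl = Unique[x∷xs]⇒x∉xs unique z∈W

    unique-Q : Unique (b ∷ Q₀ ++ r′ ∷ [])
    unique-Q = proj₁ (proj₂ (unique-++⁻ (r ∷ P) (AllPairs.tail unique)))

    disjoint : ∀ {z} → z ∈ r ∷ P → z ∉ b ∷ Q₀ ++ r′ ∷ []
    disjoint = proj₂ (proj₂ (unique-++⁻ (r ∷ P) (AllPairs.tail unique)))

    r′∈Q : r′ ∈ b ∷ Q₀ ++ r′ ∷ []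
    r′∈Q = there (∈-++⁺ʳ Q₀ (here refl))

    arc-avoids : ∀ {y} → y ∈ r ∷ P ++ b ∷ [] → Avoid a r′ y
    arc-avoids y∈ with ∈-++⁻ (r ∷ P) y∈
    ... | inj₁ y∈rP        = ≢a (∈-++⁺ˡ y∈rP) , λ { refl → disjoint y∈rP r′∈Q }
    ... | inj₂ (here refl) = ≢a (∈-++⁺ʳ (r ∷ P) (here refl))
                           , λ { refl → Unique[x∷xs]⇒x∉xs unique-Q (∈-++⁺ʳ Q₀ (here refl)) }

    arc′-avoids : ∀ {y} → y ∈ b ∷ Q₀ ++ r′ ∷ [] → Avoid a r y
    arc′-avoids y∈ = ≢a (∈-++⁺ʳ (r ∷ P) y∈) , λ { refl → disjoint (here refl) y∈ }

    arc : Reach (E G) (Avoid a r′) r b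
    arc = linked⇒reach r P (Linked.tail (proj₁ halves)) arc-avoids

    arc′ : Reach (E G) (Avoid a r) r′ b
    arc′ = reach-reverse (E-sym G) (linked⇒reach b Q₀ (proj₁ closing) arc′-avoids)

    not-a-side : a < b → Side U a b → Empty
    not-a-side a<b side = two-arcs-impossible a<b side
      (λ { refl → disjoint (here refl) r′∈Q }) (⊆U (here refl)) (⊆U (∈-++⁺ʳ (r ∷ P) r′∈Q))
      (≢a (here refl) , λ { refl → proj₂ (arc′-avoids (here refl)) refl })
      (≢a (∈-++⁺ʳ (r ∷ P) r′∈Q) , λ { refl → proj₂ (arc-avoids (∈-++⁺ʳ (r ∷ P) (here refl))) refl })
      (Linked.head (proj₁ halves)) (E-sym G (Linked.head (proj₂ closing))) arc arc′

  side-edge : ∀ {U : Subset n} {a b} P Q → a < b → Side U a b → Unique (a ∷ P ++ b ∷ Q) →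
              Linked (E G) (closed (a ∷ P ++ b ∷ Q)) → (∀ {z} → z ∈ P ++ b ∷ Q → z ∈ₛ U) → E G a b
  side-edge []      Q a<b side unique linked ⊆U = Linked.head linked
  side-edge {a = a} {b} (r ∷ P) Q a<b side unique linked ⊆U with initLast Q
  ... | []        = E-sym G (Linked.head (proj₂ (linked-split (a ∷ r ∷ P)
                      (subst (Linked (E G)) (cong (λ l → a ∷ r ∷ l) (LP.++-assoc P (b ∷ []) (a ∷ []))) linked))))
  ... | Q₀ ∷ʳ′ r′ = ⊥-elim (CycleThrough.not-a-side P Q₀ unique linked ⊆U a<b side)

  -- The vertex set of a cycle of G is a polygon: read the cycle from a, so
  -- that it has the form a P b Q, and apply side-edge.
  cycle⇒polygon : ∀ C → IsCycle (E G) C → Polygon G (listSet C)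
  cycle⇒polygon (c ∷ cs) (_ , unique , linked) {a} {b} a∈ b∈ a<b side =
    side-edge P Q a<b side
      (subst (λ W → Unique (a ∷ W)) Y++X≡ (rotate-unique X a Y (subst Unique C≡ unique)))
      (subst (λ W → Linked (E G) (closed (a ∷ W))) Y++X≡
             (rotate-closed X a Y (subst (Linked (E G) ∘ closed) C≡ linked)))
      (λ z∈ → ∈listSet⁺ (subst (_ ∈_) (sym C≡) (rotate-∈ X a Y (subst (_ ∈_) (sym Y++X≡) z∈))))
    where
    C = c ∷ cs
    a-split = ∈-∃++ (∈listSet⁻ C a∈)
    X = proj₁ a-split
    Y = proj₁ (proj₂ a-split)
    C≡ : C ≡ X ++ a ∷ Y
    C≡ = proj₂ (proj₂ a-split)
    b∈Y++X : b ∈ Y ++ X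
    b∈Y++X with ∈-++⁻ X (subst (b ∈_) C≡ (∈listSet⁻ C b∈))
    ... | inj₁ b∈X          = ∈-++⁺ʳ Y b∈X
    ... | inj₂ (here b≡a)   = ⊥-elim (FP.<⇒≢ a<b (sym b≡a))
    ... | inj₂ (there b∈Y)  = ∈-++⁺ˡ b∈Y
    b-split = ∈-∃++ b∈Y++X
    P = proj₁ b-split
    Q = proj₁ (proj₂ b-split)
    Y++X≡ : Y ++ X ≡ P ++ b ∷ Q
    Y++X≡ = proj₂ (proj₂ b-split)

face-cong : ∀ {n} (G : OuterplanarGraph n) {P Q : Fin n → Set} → (∀ {x} → P x → Q x) → (∀ {x} → Q x → P x) →
            ∀ {f} → IsIntFace P (inducedE G P) f → IsIntFace Q (inducedE G Q) f
face-cong G P⇒Q Q⇒P (⊆P , ≥3 , sides) = (λ x x∈f → P⇒Q (⊆P x x∈f)) , ≥3 , λ a b a∈f b∈f a<b → mk⇔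
  (λ (Qa , Qb , ab) → Equivalence.to (sides a b a∈f b∈f a<b) (Q⇒P Qa , Q⇒P Qb , ab))
  (λ side → let Pa , Pb , ab = Equivalence.from (sides a b a∈f b∈f a<b) side in P⇒Q Pa , P⇒Q Pb , ab)

lemma11 : ∀ {n} (G : OuterplanarGraph n) → TwoConnected G →
          (C : List (Fin n)) → IsCycle (E G) C →
          (V′ : List (Subset n)) → Unique V′ →
          (∀ f → (f ∈ V′) ⇔ Enc G C f) →
          cost V′ ≡ cycleLength C ∸ 2
lemma11 G _ (c ∷ cs) cycle V′ unique V′⇔Enc = begin
  cost V′                ≡⟨ polygon-cost G ∣U∣≥3 (cycle⇒polygon G C cycle) (unique , V′⇔faces) ⟩
  ∣ listSet C ∣ ∸ 2      ≡⟨ cong (_∸ 2) ∣U∣≡∣C∣ ⟩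
  cycleLength C ∸ 2      ∎
  where
  open ≡-Reasoning
  C = c ∷ cs
  ∣U∣≡∣C∣ : ∣ listSet C ∣ ≡ length C
  ∣U∣≡∣C∣ = ∣listSet∣ C (proj₁ (proj₂ cycle))
  ∣U∣≥3 : 3 ℕ.≤ ∣ listSet C ∣
  ∣U∣≥3 = subst (3 ℕ.≤_) (sym ∣U∣≡∣C∣) (proj₁ cycle)
  V′⇔faces : ∀ f → f ∈ V′ ⇔ Face G (listSet C) f
  V′⇔faces f = mk⇔
    (face-cong G ∈listSet⁺ (∈listSet⁻ C) ∘ Equivalence.to (V′⇔Enc f))
    (Equivalence.from (V′⇔Enc f) ∘ face-cong G (∈listSet⁻ C) ∈listSet⁺)
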